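{- For any positive integer $n$, $$\sum_{k=1}^n\frac1{k^2\binom{n+k}k}=3\sum_{k=1}^n\frac1{k^2\binom{2k}k}-\sum_{k=1}^n\frac1{k^2}.$$ -}

module Defs where

open import Data.Nat as ℕ using (ℕ; zero; suc; _≤_; z≤n; s≤s; NonZero)
open import Data.Nat.Properties using (m*n≢0)
open import Data.Nat.Combinatorics using (_C_; nCk+nC[k+1]≡[n+1]C[k+1])
open import Data.Integer using (+_)
open import Data.Rational using (ℚ; 0ℚ; _+_; _/_)
open import Relation.Binary.PropositionalEquality using (subst)

sum1to : ℕ → ((k : ℕ) → .{{NonZero k}} → ℚ) → ℚ
sum1to zero    f = 0ℚ
sum1to (suc n) f = sum1to n f + f (suc n)

recip : (d : ℕ) → .{{NonZero d}} → ℚ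
recip d = (+ 1) / d

C-nonZero : ∀ m k → k ≤ m → NonZero (m C k)
C-nonZero m       zero    _         = _
C-nonZero (suc m) (suc k) (s≤s k≤m) =
  subst NonZero (nCk+nC[k+1]≡[n+1]C[k+1] m k) (go (C-nonZero m k k≤m))
  where
  go : NonZero (m C k) → NonZero (m C k ℕ.+ m C (suc k))
  go nz with m C k
  ... | suc x = _

k≤n+k : ∀ n k → k ≤ n ℕ.+ k
k≤n+k n k = Data.Nat.Properties.m≤n+m k n
  where import Data.Nat.Properties

den₁ : ℕ → ℕ → ℕ
den₁ n k = (k ℕ.* k) ℕ.* ((n ℕ.+ k) C k)

den₂ : ℕ → ℕ
den₂ k = (k ℕ.* k) ℕ.* ((k ℕ.+ k) C k)

den₃ : ℕ → ℕ
den₃ k = k ℕ.* k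

den₁-nonZero : ∀ n k → NonZero (den₁ n (suc k))
den₁-nonZero n k = m*n≢0 (suc k ℕ.* suc k) _ {{_}} {{C-nonZero (n ℕ.+ suc k) (suc k) (k≤n+k n (suc k))}}

den₂-nonZero : ∀ k → NonZero (den₂ (suc k))
den₂-nonZero k = den₁-nonZero (suc k) k

den₃-nonZero : ∀ k → NonZero (den₃ (suc k))
den₃-nonZero k = _

term₁ : ℕ → (k : ℕ) → .{{NonZero k}} → ℚ
term₁ n (suc k) = recip (den₁ n (suc k)) {{den₁-nonZero n k}}

term₂ : (k : ℕ) → .{{NonZero k}} → ℚ
term₂ (suc k) = recip (den₂ (suc k)) {{den₂-nonZero k}}

term₃ : (k : ℕ) → .{{NonZero k}} → ℚ
term₃ (suc k) = recip (den₃ (suc k)) {{den₃-nonZero k}}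

-- Write n = m+1 and c(n,x) = 1/C(n+x,x).  The two
-- elementary binomial relations
--   C(m+k,k)·(n+k) = C(n+k,k)·n   and   C(n+k−1,k−1)·(n+k) = C(n+k,k)·k
-- show that both  c(m,k) − c(n,k)  and  c(n,k−1) − c(n,k)  are simple
-- multiples of c(n,k); comparing them gives, for every k ≥ 1,
--   1/(k² C(m+k,k)) − 1/(k² C(n+k,k)) = (c(n,k−1) − c(n,k)) / n²,
-- so the old sum minus the first m terms of the new sum telescopes to
-- (1 − c(n,m))/n² = (1 − 2/C(2n,n))/n², using C(2n,n) = 2·C(2n−1,n−1).
-- Adding the new last term 1/(n² C(2n,n)) shows that the left-hand side grows
-- by 3/(n² C(2n,n)) − 1/n², exactly as the right-hand side does.

module Submission where

open import Defs

open import Data.Nat as ℕ using (ℕ; zero; suc; NonZero)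
open import Data.Nat.Properties using (m*n≢0; m+1+n≢0)
import Data.Nat.Properties as ℕₚ
open import Data.Nat.Combinatorics using (_C_)
open import Relation.Binary.PropositionalEquality
open ≡-Reasoning

module Binomial where
  open import Data.Nat using (_+_; _*_)
  open import Data.Nat.Properties
    using (+-suc; +-identityʳ; *-distribˡ-+; m≤m+n; m+n∸m≡n)
    renaming (*-comm to ℕ-*-comm)
  open import Data.Nat.Combinatorics
    using (nC1≡n; nCk≡nC[n∸k]; nCk+nC[k+1]≡[n+1]C[k+1])
  open import Data.Nat.Solver using (module +-*-Solver)
  open +-*-Solver using (solve; _:+_; _:*_; _:=_; con)

  absorption : ∀ N k → (suc N C suc k) * suc k ≡ suc N * (N C k)
  absorption zero    zero    = refl
  absorption zero    (suc k) = refl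
  absorption (suc M) zero    = cong (_* 1) (nC1≡n (suc (suc M)))
  absorption (suc M) (suc k) = begin
    (suc (suc M) C suc (suc k)) * suc (suc k)
      ≡⟨ cong (_* suc (suc k)) (sym (nCk+nC[k+1]≡[n+1]C[k+1] (suc M) (suc k))) ⟩
    (X + Y) * suc (suc k)
      ≡⟨ solve 3 (λ x y k → (x :+ y) :* (con 2 :+ k) := x :+ (x :* (con 1 :+ k) :+ y :* (con 2 :+ k))) refl X Y k ⟩
    X + (X * suc k + Y * suc (suc k))
      ≡⟨ cong₂ (λ a b → X + (a + b)) (absorption M k) (absorption M (suc k)) ⟩
    X + (suc M * (M C k) + suc M * (M C suc k))
      ≡⟨ cong (X +_) (sym (*-distribˡ-+ (suc M) (M C k) (M C suc k))) ⟩
    X + suc M * (M C k + M C suc k)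
      ≡⟨ cong (λ z → X + suc M * z) (nCk+nC[k+1]≡[n+1]C[k+1] M k) ⟩
    X + suc M * X ∎
    where
    X = suc M C suc k
    Y = suc M C suc (suc k)

  C-sym : ∀ a b → (a + b) C a ≡ (a + b) C b
  C-sym a b = trans (nCk≡nC[n∸k] (m≤m+n a b)) (cong ((a + b) C_) (m+n∸m≡n a b))

  C-step-top : ∀ m k → ((suc m + k) C k) * suc m ≡ ((m + k) C k) * (suc m + k)
  C-step-top m k = begin
    ((suc m + k) C k) * suc m       ≡⟨ cong (_* suc m) (sym (C-sym (suc m) k)) ⟩
    (suc (m + k) C suc m) * suc m   ≡⟨ absorption (m + k) m ⟩
    suc (m + k) * ((m + k) C m)     ≡⟨ cong (suc (m + k) *_) (C-sym m k) ⟩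
    suc (m + k) * ((m + k) C k)     ≡⟨ ℕ-*-comm (suc (m + k)) _ ⟩
    ((m + k) C k) * (suc m + k)     ∎

  C-step-bottom : ∀ n j → ((n + suc j) C suc j) * suc j ≡ ((n + j) C j) * (n + suc j)
  C-step-bottom n j rewrite +-suc n j = trans (absorption (n + j) j) (ℕ-*-comm (suc (n + j)) _)

  C-central : ∀ m → (suc m + suc m) C suc m ≡ 2 * ((suc m + m) C m)
  C-central m = begin
    (suc m + suc m) C suc m
      ≡⟨ cong (λ t → suc t C suc m) (+-suc m m) ⟩
    suc (suc m + m) C suc m
      ≡⟨ sym (nCk+nC[k+1]≡[n+1]C[k+1] (suc m + m) m) ⟩
    (suc m + m) C m + (suc m + m) C suc m
      ≡⟨ cong ((suc m + m) C m +_) (C-sym (suc m) m) ⟩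
    (suc m + m) C m + (suc m + m) C m
      ≡⟨ cong ((suc m + m) C m +_) (sym (+-identityʳ _)) ⟩
    2 * ((suc m + m) C m) ∎

open Binomial

open import Data.Integer as ℤ using (+_)
import Data.Integer.Properties as ℤ
open import Data.Rational using (ℚ; _+_; _*_; _-_; _/_; 0ℚ; 1ℚ; fromℚᵘ)
open import Data.Rational.Properties
  using (toℚᵘ-injective; toℚᵘ-fromℚᵘ; toℚᵘ-homo-*; toℚᵘ-homo-+; fromℚᵘ-cong; *-comm; *-identityˡ; *-identityʳ; +-comm)
import Data.Rational.Unnormalised as ℚᵘ
import Data.Rational.Unnormalised.Properties as ℚᵘ
open import Data.Rational.Solver using (module +-*-Solver)
open +-*-Solver

ι : ℕ → ℚ
ι a = + a / 1

-- Normalisation fromℚᵘ : ℚᵘ → ℚ respects + and *; this transfers identities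
-- between the unnormalised fractions a/1, 1/d, whose arithmetic computes.
fromℚᵘ-homo-+ : ∀ p q → fromℚᵘ (p ℚᵘ.+ q) ≡ fromℚᵘ p + fromℚᵘ q
fromℚᵘ-homo-+ p q = toℚᵘ-injective (ℚᵘ.≃-trans (toℚᵘ-fromℚᵘ _)
  (ℚᵘ.≃-sym (ℚᵘ.≃-trans (toℚᵘ-homo-+ (fromℚᵘ p) (fromℚᵘ q)) (ℚᵘ.+-cong (toℚᵘ-fromℚᵘ p) (toℚᵘ-fromℚᵘ q)))))

fromℚᵘ-homo-* : ∀ p q → fromℚᵘ (p ℚᵘ.* q) ≡ fromℚᵘ p * fromℚᵘ q
fromℚᵘ-homo-* p q = toℚᵘ-injective (ℚᵘ.≃-trans (toℚᵘ-fromℚᵘ _)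
  (ℚᵘ.≃-sym (ℚᵘ.≃-trans (toℚᵘ-homo-* (fromℚᵘ p) (fromℚᵘ q)) (ℚᵘ.*-cong (toℚᵘ-fromℚᵘ p) (toℚᵘ-fromℚᵘ q)))))

ι-+ : ∀ a b → ι (a ℕ.+ b) ≡ ι a + ι b
ι-+ a b = trans (fromℚᵘ-cong {ℚᵘ.mkℚᵘ (+ (a ℕ.+ b)) 0} {ℚᵘ.mkℚᵘ (+ a) 0 ℚᵘ.+ ℚᵘ.mkℚᵘ (+ b) 0} (ℚᵘ.*≡* cross))
                (fromℚᵘ-homo-+ (ℚᵘ.mkℚᵘ (+ a) 0) (ℚᵘ.mkℚᵘ (+ b) 0))
  where
  cross : + (a ℕ.+ b) ℤ.* + 1 ≡ (+ a ℤ.* + 1 ℤ.+ + b ℤ.* + 1) ℤ.* + 1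
  cross = trans (ℤ.*-identityʳ _) (trans (ℤ.pos-+ a b)
    (sym (trans (ℤ.*-identityʳ _) (cong₂ ℤ._+_ (ℤ.*-identityʳ (+ a)) (ℤ.*-identityʳ (+ b))))))

recip-* : ∀ a b .{{_ : NonZero a}} .{{_ : NonZero b}} →
          recip (a ℕ.* b) {{m*n≢0 a b}} ≡ recip a * recip b
recip-* (suc a) (suc b) = fromℚᵘ-homo-* (ℚᵘ.mkℚᵘ (+ 1) a) (ℚᵘ.mkℚᵘ (+ 1) b)

ι-recip : ∀ a .{{_ : NonZero a}} → ι a * recip a ≡ 1ℚ
ι-recip (suc a) = trans (sym (fromℚᵘ-homo-* (ℚᵘ.mkℚᵘ (+ suc a) 0) (ℚᵘ.mkℚᵘ (+ 1) a)))
                        (fromℚᵘ-cong {ℚᵘ.mkℚᵘ (+ suc a) 0 ℚᵘ.* ℚᵘ.mkℚᵘ (+ 1) a} {ℚᵘ.mkℚᵘ (+ 1) 0} (ℚᵘ.*≡* cross))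
  where
  cross : (+ suc a ℤ.* + 1) ℤ.* + 1 ≡ + 1 ℤ.* + (1 ℕ.* suc a)
  cross = trans (ℤ.*-identityʳ _) (trans (ℤ.*-identityʳ _)
    (sym (trans (ℤ.*-identityˡ _) (cong +_ (ℕₚ.*-identityˡ (suc a))))))

recip-cong : ∀ {a b} → a ≡ b → .{{_ : NonZero a}} .{{_ : NonZero b}} → recip a ≡ recip b
recip-cong refl = refl

recip-cross : ∀ a b x y .{{_ : NonZero a}} .{{_ : NonZero b}} .{{_ : NonZero x}} .{{_ : NonZero y}} →
              a ℕ.* b ≡ x ℕ.* y → recip a ≡ ι b * (recip x * recip y)
recip-cross a b x y ab≡xy = begin
  recip a                          ≡⟨ sym (*-identityʳ (recip a)) ⟩
  recip a * 1ℚ                     ≡⟨ cong (recip a *_) (sym (ι-recip b)) ⟩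
  recip a * (ι b * recip b)        ≡⟨ solve 3 (λ r i s → r :* (i :* s) := i :* (r :* s)) refl (recip a) (ι b) (recip b) ⟩
  ι b * (recip a * recip b)        ≡⟨ cong (ι b *_) (sym (recip-* a b)) ⟩
  ι b * recip (a ℕ.* b) {{m*n≢0 a b}}
                                   ≡⟨ cong (ι b *_) (recip-cong ab≡xy {{m*n≢0 a b}} {{m*n≢0 x y}}) ⟩
  ι b * recip (x ℕ.* y) {{m*n≢0 x y}}
                                   ≡⟨ cong (ι b *_) (recip-* x y) ⟩
  ι b * (recip x * recip y)        ∎

shift : ∀ a b y .{{_ : NonZero a}} → (ι a + ι b) * (y * recip a) - y ≡ ι b * (y * recip a)
shift a b y = begin
  (ι a + ι b) * (y * recip a) - y
    ≡⟨ solve 4 (λ i j r y → (i :+ j) :* (y :* r) :- y := (i :* r) :* y :+ j :* (y :* r) :- y) refl (ι a) (ι b) (recip a) y ⟩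
  (ι a * recip a) * y + ι b * (y * recip a) - y
    ≡⟨ cong (λ t → t * y + ι b * (y * recip a) - y) (ι-recip a) ⟩
  1ℚ * y + ι b * (y * recip a) - y
    ≡⟨ solve 2 (λ y t → con 1ℚ :* y :+ t :- y := t) refl y (ι b * (y * recip a)) ⟩
  ι b * (y * recip a) ∎

absorb : ∀ a b y .{{_ : NonZero a}} .{{_ : NonZero b}} → recip a * recip a * (ι a * (y * recip b)) ≡ recip a * recip b * y
absorb a b y = begin
  recip a * recip a * (ι a * (y * recip b))
    ≡⟨ solve 4 (λ r i y s → r :* r :* (i :* (y :* s)) := (i :* r) :* (r :* s :* y)) refl (recip a) (ι a) y (recip b) ⟩
  (ι a * recip a) * (recip a * recip b * y)
    ≡⟨ cong (_* (recip a * recip b * y)) (ι-recip a) ⟩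
  1ℚ * (recip a * recip b * y)
    ≡⟨ *-identityˡ _ ⟩
  recip a * recip b * y ∎

telescope : ∀ m (f g : (k : ℕ) → .{{NonZero k}} → ℚ) (a : ℕ → ℚ) (c : ℚ) →
            (∀ j → f (suc j) - g (suc j) ≡ (a j - a (suc j)) * c) →
            sum1to m f - sum1to m g ≡ (a 0 - a m) * c
telescope zero    f g a c step = solve 2 (λ x c → con 0ℚ :- con 0ℚ := (x :- x) :* c) refl (a 0) c
telescope (suc m) f g a c step = begin
  (F + f (suc m)) - (G + g (suc m))
    ≡⟨ solve 4 (λ F f G g → (F :+ f) :- (G :+ g) := (F :- G) :+ (f :- g)) refl F (f (suc m)) G (g (suc m)) ⟩
  (F - G) + (f (suc m) - g (suc m))
    ≡⟨ cong₂ _+_ (telescope m f g a c step) (step m) ⟩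
  (a 0 - a m) * c + (a m - a (suc m)) * c
    ≡⟨ solve 4 (λ x y z c → (x :- y) :* c :+ (y :- z) :* c := (x :- z) :* c) refl (a 0) (a m) (a (suc m)) c ⟩
  (a 0 - a (suc m)) * c ∎
  where
  F = sum1to m f
  G = sum1to m g

invC : ℕ → ℕ → ℚ
invC n x = recip ((n ℕ.+ x) C x) {{C-nonZero (n ℕ.+ x) x (k≤n+k n x)}}

term₁-factor : ∀ n j → term₁ n (suc j) ≡ recip (suc j) * recip (suc j) * invC n (suc j)
term₁-factor n j =
  trans (recip-* (suc j ℕ.* suc j) ((n ℕ.+ suc j) C suc j) {{_}} {{C-nonZero _ _ (k≤n+k n (suc j))}})
        (cong (_* invC n (suc j)) (recip-* (suc j) (suc j)))

invC-step-top : ∀ m k .{{_ : NonZero k}} →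
                invC m k - invC (suc m) k ≡ ι k * (invC (suc m) k * recip (suc m))
invC-step-top m k = begin
  invC m k - c                  ≡⟨ cong (_- c) scaled ⟩
  (ι n + ι k) * (c * rn) - c    ≡⟨ shift n k c ⟩
  ι k * (c * rn)                ∎
  where
  n  = suc m
  c  = invC n k
  rn = recip n
  scaled : invC m k ≡ (ι n + ι k) * (c * rn)
  scaled = trans (recip-cross ((m ℕ.+ k) C k) (n ℕ.+ k) ((n ℕ.+ k) C k) n
                   {{C-nonZero _ _ (k≤n+k m k)}} {{_}} {{C-nonZero _ _ (k≤n+k n k)}}
                   (sym (C-step-top m k)))
                 (cong (_* (c * rn)) (ι-+ n k))

invC-step-bottom : ∀ n j .{{_ : NonZero n}} →
                   invC n j - invC n (suc j) ≡ ι n * (invC n (suc j) * recip (suc j))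
invC-step-bottom n j = begin
  invC n j - c                  ≡⟨ cong (_- c) scaled ⟩
  (ι k + ι n) * (c * rk) - c    ≡⟨ shift k n c ⟩
  ι n * (c * rk)                ∎
  where
  k  = suc j
  c  = invC n k
  rk = recip k
  scaled : invC n j ≡ (ι k + ι n) * (c * rk)
  scaled = trans (recip-cross ((n ℕ.+ j) C j) (n ℕ.+ k) ((n ℕ.+ k) C k) k
                   {{C-nonZero _ _ (k≤n+k n j)}} {{ℕ.≢-nonZero (m+1+n≢0 n)}} {{C-nonZero _ _ (k≤n+k n k)}}
                   (sym (C-step-bottom n j)))
                 (cong (_* (c * rk)) (trans (ι-+ n k) (+-comm (ι n) (ι k))))

-- Key identity, for n = m+1 and k ≥ 1:
--   1/(k² C(m+k,k)) − 1/(k² C(n+k,k)) = (invC n (k−1) − invC n k) / n²;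
-- both sides equal invC n k /(kn) by the two step lemmas.
term₁-telescopes : ∀ m j → term₁ m (suc j) - term₁ (suc m) (suc j) ≡
                   (invC (suc m) j - invC (suc m) (suc j)) * (recip (suc m) * recip (suc m))
term₁-telescopes m j = begin
  term₁ m k - term₁ n k
    ≡⟨ cong₂ _-_ (term₁-factor m j) (term₁-factor n j) ⟩
  rk * rk * invC m k - rk * rk * c
    ≡⟨ solve 3 (λ r x y → r :* x :- r :* y := r :* (x :- y)) refl (rk * rk) (invC m k) c ⟩
  rk * rk * (invC m k - c)
    ≡⟨ cong (rk * rk *_) (invC-step-top m k) ⟩
  rk * rk * (ι k * (c * rn))
    ≡⟨ absorb k n c ⟩
  rk * rn * c
    ≡⟨ cong (_* c) (*-comm rk rn) ⟩
  rn * rk * c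
    ≡⟨ sym (absorb n k c) ⟩
  rn * rn * (ι n * (c * rk))
    ≡⟨ cong (rn * rn *_) (sym (invC-step-bottom n j)) ⟩
  rn * rn * (invC n j - c)
    ≡⟨ *-comm (rn * rn) _ ⟩
  (invC n j - c) * (rn * rn) ∎
  where
  n  = suc m
  k  = suc j
  c  = invC n k
  rn = recip n
  rk = recip k

invC-central : ∀ m → invC (suc m) m ≡ ι 2 * invC (suc m) (suc m)
invC-central m = trans
  (recip-cross ((n ℕ.+ m) C m) 2 ((n ℕ.+ n) C n) 1
     {{C-nonZero _ _ (k≤n+k n m)}} {{_}} {{C-nonZero _ _ (k≤n+k n n)}}
     central)
  (cong (ι 2 *_) (*-identityʳ (invC n n)))
  where
  n = suc m
  central : ((n ℕ.+ m) C m) ℕ.* 2 ≡ ((n ℕ.+ n) C n) ℕ.* 1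
  central = trans (ℕₚ.*-comm ((n ℕ.+ m) C m) 2)
                  (sym (trans (ℕₚ.*-identityʳ ((n ℕ.+ n) C n)) (C-central m)))

lhs-step : ∀ m → sum1to (suc m) (term₁ (suc m)) ≡
           sum1to m (term₁ m) + ((+ 3 / 1) * term₂ (suc m) - term₃ (suc m))
lhs-step m = begin
  X + term₂ n
    ≡⟨ cong (λ t → X + t) (term₁-factor n m) ⟩
  X + rn * rn * B
    ≡⟨ solve 3 (λ X S t → X :+ t := S :- (S :- X) :+ t) refl X S (rn * rn * B) ⟩
  S - (S - X) + rn * rn * B
    ≡⟨ cong (λ d → S - d + rn * rn * B) old-minus-new ⟩
  S - (1ℚ - ι 2 * B) * (rn * rn) + rn * rn * B
    ≡⟨ solve 3 (λ S B r → S :- (con 1ℚ :- con (ι 2) :* B) :* (r :* r) :+ r :* r :* B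
                          := S :+ (con (+ 3 / 1) :* (r :* r :* B) :- r :* r)) refl S B rn ⟩
  S + ((+ 3 / 1) * (rn * rn * B) - rn * rn)
    ≡⟨ cong₂ (λ t u → S + ((+ 3 / 1) * t - u)) (sym (term₁-factor n m)) (sym (recip-* n n)) ⟩
  S + ((+ 3 / 1) * term₂ n - term₃ n) ∎
  where
  n  = suc m
  S  = sum1to m (term₁ m)
  X  = sum1to m (term₁ n)
  B  = invC n n
  rn = recip n
  old-minus-new : S - X ≡ (1ℚ - ι 2 * B) * (rn * rn)
  old-minus-new = trans (telescope m (term₁ m) (term₁ n) (invC n) (rn * rn) (term₁-telescopes m))
                        (cong (λ t → (1ℚ - t) * (rn * rn)) (invC-central m))

identity : ∀ n → sum1to n (term₁ n) ≡ (+ 3 / 1) * sum1to n term₂ - sum1to n term₃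
identity zero    = refl
identity (suc m) = begin
  sum1to (suc m) (term₁ (suc m))
    ≡⟨ lhs-step m ⟩
  sum1to m (term₁ m) + ((+ 3 / 1) * t₂ - t₃)
    ≡⟨ cong (_+ ((+ 3 / 1) * t₂ - t₃)) (identity m) ⟩
  ((+ 3 / 1) * S₂ - S₃) + ((+ 3 / 1) * t₂ - t₃)
    ≡⟨ solve 4 (λ S₂ S₃ t₂ t₃ → (con (+ 3 / 1) :* S₂ :- S₃) :+ (con (+ 3 / 1) :* t₂ :- t₃)
                                := con (+ 3 / 1) :* (S₂ :+ t₂) :- (S₃ :+ t₃)) refl S₂ S₃ t₂ t₃ ⟩
  (+ 3 / 1) * (S₂ + t₂) - (S₃ + t₃) ∎
  where
  S₂ = sum1to m term₂
  S₃ = sum1to m term₃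
  t₂ = term₂ (suc m)
  t₃ = term₃ (suc m)

lemma2p3 : (n : ℕ) → .{{NonZero n}} →
    sum1to n (term₁ n) ≡ (+ 3 / 1) * sum1to n term₂ - sum1to n term₃
lemma2p3 n = identity n
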